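{- Let $L$ and $M$ be two modular lattices of finite length, with rank functions $\rk_L$ and $\rk_M$, and suppose given a Galois connection $(\cdot)^\circ:L\to M$, $(\cdot)^\circ:M\to L$ between them. Define $\deg_L(l)=\rk_M(l^\circ)$ for $l\in L$ and $\deg_M(m)=\rk_L(m^\circ)$ for $m\in M$. Then $\deg_L$ and $\deg_M$ are lower semimodular (and bounded from above), so that $(L,\deg_L)$ and $(M,\deg_M)$ are Harder-Narasimhan lattices.
   Context: A (antitone) Galois connection between lattices $L$ and $M$ is a pair of order-reversing maps $(\cdot)^\circ:L\to M$ and $(\cdot)^\circ:M\to L$ such that every $x$ in $L$ or in $M$ satisfies $x\subset x^{\circ\circ}$. The rank of an element of a lattice of finite length is the maximal length of a chain from the least element to it. A function $f$ is lower semimodular if $f(x)+f(y)\le f(x\vee y)+f(x\wedge y)$ for all $x,y$. A Harder-Narasimhan lattice is a modular lattice of finite length with a degree function that is lower semimodular and bounded from above. -}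

module Defs where

open import Level using (Level; _⊔_)
open import Data.Nat using (ℕ; suc; _+_) renaming (_≤_ to _≤ℕ_)
open import Data.Fin using (Fin; zero; fromℕ; inject₁)
open import Data.Product using (Σ; ∃; _×_)
open import Relation.Nullary using (¬_)
open import Relation.Binary.Lattice.Bundles using (Lattice)

module _ {c ℓ₁ ℓ₂ : Level} (L : Lattice c ℓ₁ ℓ₂) where
  open Lattice L

  _<ₗ_ : Carrier → Carrier → Set (ℓ₁ ⊔ ℓ₂)
  x <ₗ y = (x ≤ y) × ¬ (x ≈ y)

  record Chain (a b : Carrier) (n : ℕ) : Set (c ⊔ ℓ₁ ⊔ ℓ₂) where
    field
      elt   : Fin (suc n) → Carrier
      start : elt zero ≈ a
      end   : elt (fromℕ n) ≈ b
      step  : (i : Fin n) → elt (inject₁ i) <ₗ elt (Fin.suc i)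

  FiniteLength : Set (c ⊔ ℓ₁ ⊔ ℓ₂)
  FiniteLength = Σ ℕ λ N → ∀ a b n → Chain a b n → n ≤ℕ N

  IsModular : Set (c ⊔ ℓ₁ ⊔ ℓ₂)
  IsModular = ∀ x y z → x ≤ z → (x ∨ (y ∧ z)) ≈ ((x ∨ y) ∧ z)

  IsLeast : Carrier → Set (c ⊔ ℓ₂)
  IsLeast b = ∀ x → b ≤ x

  IsRank : (Carrier → ℕ) → Set (c ⊔ ℓ₁ ⊔ ℓ₂)
  IsRank rk = ∀ x →
    (Σ Carrier λ b → IsLeast b × Chain b x (rk x))
    × (∀ b n → IsLeast b → Chain b x n → n ≤ℕ rk x)

  LowerSemimodular : (Carrier → ℕ) → Set c
  LowerSemimodular f = ∀ x y → f x + f y ≤ℕ f (x ∨ y) + f (x ∧ y)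

  BoundedAbove : (Carrier → ℕ) → Set c
  BoundedAbove f = Σ ℕ λ B → ∀ x → f x ≤ℕ B

  IsHNLattice : (Carrier → ℕ) → Set (c ⊔ ℓ₁ ⊔ ℓ₂)
  IsHNLattice deg = IsModular × FiniteLength × LowerSemimodular deg × BoundedAbove deg

module _ {a ℓ₁ ℓ₂ b ℓ₃ ℓ₄ : Level} (L : Lattice a ℓ₁ ℓ₂) (M : Lattice b ℓ₃ ℓ₄) where
  private
    module L = Lattice L
    module M = Lattice M

  IsGaloisConnection : (L.Carrier → M.Carrier) → (M.Carrier → L.Carrier) → Set (a ⊔ ℓ₂ ⊔ b ⊔ ℓ₄)
  IsGaloisConnection f g =
    (∀ x y → x L.≤ y → f y M.≤ f x)
    × (∀ x y → x M.≤ y → g y L.≤ g x)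
    × (∀ x → x L.≤ g (f x))
    × (∀ y → y M.≤ f (g y))

-- An antitone Galois connection satisfies f x ∨ f y ≤ f (x ∧ y) and, since
-- x ∨ y ≤ g (f x ∧ f y), also f x ∧ f y ≤ f (x ∨ y).  The rank of a modular lattice is
-- monotone and satisfies rk a + rk b ≤ rk (a ∨ b) + rk (a ∧ b): by modularity no strict
-- step x < y becomes an equality both after meeting and after joining with b, so a
-- maximal chain below a yields a chain below a ∧ b and a chain from b to a ∨ b of total
-- length at least rk a.  Composing the two gives lower semimodularity of deg = rk ∘ f;
-- deg is bounded by the length of the codomain, and the situation is symmetric in L, M.
module Submission where

open import Defs
open import Level using (Level; _⊔_)
open import Data.Nat using (ℕ; zero; suc; _+_; s≤s) renaming (_≤_ to _≤ℕ_; _≤?_ to _≤ℕ?_)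
open import Data.Nat.Properties
  using (≤-refl; ≤-reflexive; ≤-trans; +-mono-≤; +-monoʳ-≤; +-comm; +-assoc; +-suc; n≤1+n;
         m+n≤o⇒m≤o; module ≤-Reasoning)
open import Data.Fin using (Fin; zero; suc; inject₁)
open import Data.Product using (_×_; _,_; proj₁; proj₂)
open import Relation.Nullary using (¬_; Dec; yes; no)
open import Relation.Nullary.Negation using (¬¬-map; negated-stable; contradiction)
open import Relation.Nullary.Decidable using (¬¬-excluded-middle; decidable-stable)
open import Relation.Binary.PropositionalEquality using (cong; sym)
open import Relation.Binary.Lattice.Bundles using (Lattice)
import Relation.Binary.Construct.NonStrictToStrict as NonStrictToStrict
import Relation.Binary.Lattice.Properties.Lattice as LatticeProperties
import Relation.Binary.Lattice.Properties.MeetSemilattice as MeetProperties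
import Relation.Binary.Lattice.Properties.JoinSemilattice as JoinProperties
import Relation.Binary.Reasoning.Setoid as ≈-Reasoning

-- Lattice equality is not
-- decidable, so case splits on it happen under ¬ ¬; the results are inequalities of
-- naturals, which are stable.
private
  _>>=_ : ∀ {a b} {A : Set a} {B : Set b} → ¬ ¬ A → (A → ¬ ¬ B) → ¬ ¬ B
  m >>= k = negated-stable (¬¬-map k m)

  pure : ∀ {a} {A : Set a} → A → ¬ ¬ A
  pure = contradiction

module StrictChains {c ℓ₁ ℓ₂ : Level} (L : Lattice c ℓ₁ ℓ₂) where
  open Lattice L
  open NonStrictToStrict _≈_ _≤_ using (_<_)

  <-respˡ-≈ : ∀ {x x' y} → x ≈ x' → x < y → x' < y
  <-respˡ-≈ = NonStrictToStrict.<-respˡ-≈ _≈_ _≤_ Eq.trans (proj₂ ≤-resp-≈)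

  <-respʳ-≈ : ∀ {x y y'} → y ≈ y' → x < y → x < y'
  <-respʳ-≈ = NonStrictToStrict.<-respʳ-≈ _≈_ _≤_ Eq.sym Eq.trans (proj₁ ≤-resp-≈)

  infixr 5 _∷_ _++_

  data StrictChain : Carrier → Carrier → ℕ → Set (c ⊔ ℓ₁ ⊔ ℓ₂) where
    [_] : ∀ {x y} → x ≈ y → StrictChain x y 0
    _∷_ : ∀ {x y z n} → x < y → StrictChain y z n → StrictChain x z (suc n)

  fromChain : ∀ {x y} n → Chain L x y n → StrictChain x y n
  fromChain zero ch = [ Eq.trans (Eq.sym (Chain.start ch)) (Chain.end ch) ]
  fromChain {y = y} (suc n) ch = <-respˡ-≈ (Chain.start ch) (Chain.step ch zero) ∷ fromChain n tail
    where
    tail : Chain L (Chain.elt ch (suc zero)) y n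
    tail = record
      { elt = λ i → Chain.elt ch (suc i) ; start = Eq.refl ; end = Chain.end ch
      ; step = λ i → Chain.step ch (suc i) }

  toChain : ∀ {x y n} → StrictChain x y n → Chain L x y n
  toChain {x} [ x≈y ] = record { elt = λ _ → x ; start = Eq.refl ; end = x≈y ; step = λ () }
  toChain {x} {z} {suc n} (_∷_ {y = y} x<y rest) =
    record { elt = elt ; start = Eq.refl ; end = Chain.end tail ; step = step }
    where
    tail : Chain L y z n
    tail = toChain rest
    elt : Fin (suc (suc n)) → Carrier
    elt zero = x
    elt (suc i) = Chain.elt tail i
    step : (i : Fin (suc n)) → elt (inject₁ i) < elt (suc i)
    step zero = <-respʳ-≈ (Eq.sym (Chain.start tail)) x<y
    step (suc i) = Chain.step tail i

  chain-respˡ-≈ : ∀ {x x' z n} → x ≈ x' → StrictChain x' z n → StrictChain x z n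
  chain-respˡ-≈ x≈x' [ x'≈z ] = [ Eq.trans x≈x' x'≈z ]
  chain-respˡ-≈ x≈x' (x'<y ∷ rest) = <-respˡ-≈ (Eq.sym x≈x') x'<y ∷ rest

  chain-respʳ-≈ : ∀ {x z z' n} → z ≈ z' → StrictChain x z n → StrictChain x z' n
  chain-respʳ-≈ z≈z' [ x≈z ] = [ Eq.trans x≈z z≈z' ]
  chain-respʳ-≈ z≈z' (x<y ∷ rest) = x<y ∷ chain-respʳ-≈ z≈z' rest

  _++_ : ∀ {x y z m n} → StrictChain x y m → StrictChain y z n → StrictChain x z (m + n)
  [ x≈y ] ++ rest = chain-respˡ-≈ x≈y rest
  (x<y ∷ chain) ++ rest = x<y ∷ (chain ++ rest)

module ModularProjection {c ℓ₁ ℓ₂ : Level} (L : Lattice c ℓ₁ ℓ₂) (modular : IsModular L)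
    (b : Lattice.Carrier L) where
  open Lattice L
  open NonStrictToStrict _≈_ _≤_ using (_<_)
  open StrictChains L
  open LatticeProperties L using (∧-absorbs-∨; ∨-absorbs-∧)
  open MeetProperties meetSemilattice using (∧-monotonic; ∧-cong; ∧-comm)
  open JoinProperties joinSemilattice using (∨-monotonic; ∨-cong)

  ∧∨-cancel : ∀ {x y} → x ≤ y → x ∧ b ≈ y ∧ b → x ∨ b ≈ y ∨ b → y ≈ x
  ∧∨-cancel {x} {y} x≤y meet≈ join≈ = begin
    y            ≈⟨ Eq.sym (∧-absorbs-∨ y b) ⟩
    y ∧ (y ∨ b)  ≈⟨ ∧-cong Eq.refl (Eq.sym join≈) ⟩
    y ∧ (x ∨ b)  ≈⟨ ∧-comm y (x ∨ b) ⟩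
    (x ∨ b) ∧ y  ≈⟨ Eq.sym (modular x b y x≤y) ⟩
    x ∨ (b ∧ y)  ≈⟨ ∨-cong Eq.refl (Eq.trans (∧-comm b y) (Eq.sym meet≈)) ⟩
    x ∨ (x ∧ b)  ≈⟨ ∨-absorbs-∧ x b ⟩
    x            ∎
    where open ≈-Reasoning setoid

  record Projection (x y : Carrier) (n : ℕ) : Set (c ⊔ ℓ₁ ⊔ ℓ₂) where
    field
      {meetLength joinLength} : ℕ
      meetChain : StrictChain (x ∧ b) (y ∧ b) meetLength
      joinChain : StrictChain (x ∨ b) (y ∨ b) joinLength
      length≤   : n ≤ℕ meetLength + joinLength

  project-step : ∀ {x x' y n} → x < x' → Projection x' y n →
    Dec (x ∧ b ≈ x' ∧ b) → Dec (x ∨ b ≈ x' ∨ b) → Projection x y (suc n)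
  project-step (x≤x' , x≉x') p (yes meet≈) (yes join≈) =
    contradiction (Eq.sym (∧∨-cancel x≤x' meet≈ join≈)) x≉x'
  project-step (x≤x' , _) p (yes meet≈) (no join≉) = record
    { meetChain = chain-respˡ-≈ meet≈ meetChain
    ; joinChain = (∨-monotonic x≤x' refl , join≉) ∷ joinChain
    ; length≤ = ≤-trans (s≤s length≤) (≤-reflexive (sym (+-suc meetLength joinLength))) }
    where open Projection p
  project-step (x≤x' , _) p (no meet≉) (yes join≈) = record
    { meetChain = (∧-monotonic x≤x' refl , meet≉) ∷ meetChain
    ; joinChain = chain-respˡ-≈ join≈ joinChain
    ; length≤ = s≤s length≤ }
    where open Projection p
  project-step (x≤x' , _) p (no meet≉) (no join≉) = record
    { meetChain = (∧-monotonic x≤x' refl , meet≉) ∷ meetChain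
    ; joinChain = (∨-monotonic x≤x' refl , join≉) ∷ joinChain
    ; length≤ = s≤s (≤-trans length≤ (+-monoʳ-≤ meetLength (n≤1+n joinLength))) }
    where open Projection p

  project : ∀ {x y n} → StrictChain x y n → ¬ ¬ Projection x y n
  project [ x≈y ] = pure record
    { meetChain = [ ∧-cong x≈y Eq.refl ] ; joinChain = [ ∨-cong x≈y Eq.refl ] ; length≤ = ≤-refl }
  project (x<x' ∷ rest) = do
    p ← project rest
    meet? ← ¬¬-excluded-middle
    join? ← ¬¬-excluded-middle
    pure (project-step x<x' p meet? join?)

module Rank {c ℓ₁ ℓ₂ : Level} (L : Lattice c ℓ₁ ℓ₂) (rk : Lattice.Carrier L → ℕ)
    (isRank : IsRank L rk) where
  open Lattice L
  open StrictChains L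
  open JoinProperties joinSemilattice using (x≤y⇒x∨y≈y)
  open MeetProperties meetSemilattice using (y≤x⇒x∧y≈y; ∧-comm)

  length≤rank : ∀ {⊥ x n} → IsLeast L ⊥ → StrictChain ⊥ x n → n ≤ℕ rk x
  length≤rank {⊥} {x} {n} ⊥-least chain = proj₂ (isRank x) ⊥ n ⊥-least (toChain chain)

  record MaximalChain (x : Carrier) : Set (c ⊔ ℓ₁ ⊔ ℓ₂) where
    field
      bottom       : Carrier
      bottom-least : IsLeast L bottom
      chain        : StrictChain bottom x (rk x)

  maximalChain : ∀ x → MaximalChain x
  maximalChain x with proj₁ (isRank x)
  ... | ⊥ , ⊥-least , chain = record
    { bottom = ⊥ ; bottom-least = ⊥-least ; chain = fromChain (rk x) chain }

  rank-bounded : FiniteLength L → BoundedAbove L rk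
  rank-bounded (N , bound) = N , λ x → let open MaximalChain (maximalChain x) in
    bound bottom x (rk x) (toChain chain)

  rank-monotonic : ∀ {u v} → u ≤ v → rk u ≤ℕ rk v
  rank-monotonic {u} {v} u≤v = decidable-stable (rk u ≤ℕ? rk v) do
    u≈v? ← ¬¬-excluded-middle
    pure (extend u≈v?)
    where
    open MaximalChain (maximalChain u)
    extend : Dec (u ≈ v) → rk u ≤ℕ rk v
    extend (yes u≈v) = length≤rank bottom-least (chain-respʳ-≈ u≈v chain)
    extend (no u≉v) =
      m+n≤o⇒m≤o (rk u) (length≤rank bottom-least (chain ++ (u≤v , u≉v) ∷ [ Eq.refl ]))

  rank-lowerSemimodular : IsModular L → LowerSemimodular L rk
  rank-lowerSemimodular modular a b = decidable-stable (_ ≤ℕ? _) do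
    p ← project chain
    pure (combine p)
    where
    open ModularProjection L modular b
    open MaximalChain (maximalChain a)
    module B = MaximalChain (maximalChain b)
    combine : Projection bottom a (rk a) → rk a + rk b ≤ℕ rk (a ∨ b) + rk (a ∧ b)
    combine p = begin
      rk a + rk b              ≤⟨ +-mono-≤ length≤ ≤-refl ⟩
      (m + j) + rk b           ≡⟨ +-assoc m j (rk b) ⟩
      m + (j + rk b)           ≡⟨ cong (m +_) (+-comm j (rk b)) ⟩
      m + (rk b + j)           ≤⟨ +-mono-≤ meet-bound join-bound ⟩
      rk (a ∧ b) + rk (a ∨ b)  ≡⟨ +-comm (rk (a ∧ b)) (rk (a ∨ b)) ⟩
      rk (a ∨ b) + rk (a ∧ b)  ∎
      where
      open Projection p renaming (meetLength to m; joinLength to j)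
      open ≤-Reasoning
      meet-bound : m ≤ℕ rk (a ∧ b)
      meet-bound = length≤rank bottom-least (chain-respˡ-≈ bottom≈bottom∧b meetChain)
        where
        bottom≈bottom∧b : bottom ≈ bottom ∧ b
        bottom≈bottom∧b = Eq.sym (Eq.trans (∧-comm bottom b) (y≤x⇒x∧y≈y (bottom-least b)))
      join-bound : rk b + j ≤ℕ rk (a ∨ b)
      join-bound = length≤rank B.bottom-least (B.chain ++ chain-respˡ-≈ b≈bottom∨b joinChain)
        where
        b≈bottom∨b : b ≈ bottom ∨ b
        b≈bottom∨b = Eq.sym (x≤y⇒x∨y≈y (bottom-least b))

module AntitoneGalois {a ℓ₁ ℓ₂ b ℓ₃ ℓ₄ : Level} (L : Lattice a ℓ₁ ℓ₂) (M : Lattice b ℓ₃ ℓ₄)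
    {f : Lattice.Carrier L → Lattice.Carrier M} {g : Lattice.Carrier M → Lattice.Carrier L}
    (galois : IsGaloisConnection L M f g) where
  private
    module L = Lattice L
    module M = Lattice M
  open M using (_∧_; _∨_; _≤_)

  f-antitone : ∀ {x y} → x L.≤ y → f y ≤ f x
  f-antitone = proj₁ galois _ _

  g-antitone : ∀ {x y} → x ≤ y → g y L.≤ g x
  g-antitone = proj₁ (proj₂ galois) _ _

  fx∨fy≤f[x∧y] : ∀ x y → f x ∨ f y ≤ f (x L.∧ y)
  fx∨fy≤f[x∧y] x y = M.∨-least (f-antitone (L.x∧y≤x x y)) (f-antitone (L.x∧y≤y x y))

  fx∧fy≤f[x∨y] : ∀ x y → f x ∧ f y ≤ f (x L.∨ y)
  fx∧fy≤f[x∨y] x y = M.trans (unitᴹ (f x ∧ f y)) (f-antitone x∨y≤g[fx∧fy])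
    where
    unitᴸ : ∀ x → x L.≤ g (f x)
    unitᴸ = proj₁ (proj₂ (proj₂ galois))
    unitᴹ : ∀ y → y ≤ f (g y)
    unitᴹ = proj₂ (proj₂ (proj₂ galois))
    x∨y≤g[fx∧fy] : x L.∨ y L.≤ g (f x ∧ f y)
    x∨y≤g[fx∧fy] = L.∨-least (L.trans (unitᴸ x) (g-antitone (M.x∧y≤x _ _)))
                             (L.trans (unitᴸ y) (g-antitone (M.x∧y≤y _ _)))

isGaloisConnection-sym : ∀ {a ℓ₁ ℓ₂ b ℓ₃ ℓ₄} (L : Lattice a ℓ₁ ℓ₂) (M : Lattice b ℓ₃ ℓ₄)
  {f : Lattice.Carrier L → Lattice.Carrier M} {g : Lattice.Carrier M → Lattice.Carrier L} →
  IsGaloisConnection L M f g → IsGaloisConnection M L g f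
isGaloisConnection-sym _ _ (f-antitone , g-antitone , unitᴸ , unitᴹ) =
  g-antitone , f-antitone , unitᴹ , unitᴸ

module _ {a ℓ₁ ℓ₂ b ℓ₃ ℓ₄ : Level} (L : Lattice a ℓ₁ ℓ₂) (M : Lattice b ℓ₃ ℓ₄)
    (rk : Lattice.Carrier M → ℕ) (isRank : IsRank M rk)
    {f : Lattice.Carrier L → Lattice.Carrier M} {g : Lattice.Carrier M → Lattice.Carrier L} where
  private
    module L = Lattice L
    module M = Lattice M
  open Rank M rk isRank

  degree-lowerSemimodular : IsModular M → IsGaloisConnection L M f g →
    LowerSemimodular L (λ l → rk (f l))
  degree-lowerSemimodular modular galois x y = begin
    rk (f x) + rk (f y)                        ≤⟨ rank-lowerSemimodular modular (f x) (f y) ⟩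
    rk (f x M.∨ f y) + rk (f x M.∧ f y)        ≤⟨ +-mono-≤ (rank-monotonic (fx∨fy≤f[x∧y] x y))
                                                          (rank-monotonic (fx∧fy≤f[x∨y] x y)) ⟩
    rk (f (x L.∧ y)) + rk (f (x L.∨ y))        ≡⟨ +-comm (rk (f (x L.∧ y))) (rk (f (x L.∨ y))) ⟩
    rk (f (x L.∨ y)) + rk (f (x L.∧ y))        ∎
    where
    open ≤-Reasoning
    open AntitoneGalois L M galois

  degree-boundedAbove : FiniteLength M → BoundedAbove L (λ l → rk (f l))
  degree-boundedAbove finite = let (B , rk≤B) = rank-bounded finite in B , λ x → rk≤B (f x)

  degree-isHNLattice : IsModular L → FiniteLength L → IsModular M → FiniteLength M →
    IsGaloisConnection L M f g → IsHNLattice L (λ l → rk (f l))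
  degree-isHNLattice modularᴸ finiteᴸ modularᴹ finiteᴹ galois =
    modularᴸ , finiteᴸ , degree-lowerSemimodular modularᴹ galois , degree-boundedAbove finiteᴹ

theorem1p16 : {a ℓ₁ ℓ₂ b ℓ₃ ℓ₄ : Level} (L : Lattice a ℓ₁ ℓ₂) (M : Lattice b ℓ₃ ℓ₄)
    → IsModular L → FiniteLength L → IsModular M → FiniteLength M
    → (rkL : Lattice.Carrier L → ℕ) → IsRank L rkL
    → (rkM : Lattice.Carrier M → ℕ) → IsRank M rkM
    → (f : Lattice.Carrier L → Lattice.Carrier M) (g : Lattice.Carrier M → Lattice.Carrier L)
    → IsGaloisConnection L M f g
    → IsHNLattice L (λ l → rkM (f l)) × IsHNLattice M (λ m → rkL (g m))
theorem1p16 L M modularᴸ finiteᴸ modularᴹ finiteᴹ rkL isRankᴸ rkM isRankᴹ f g galois =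
    degree-isHNLattice L M rkM isRankᴹ modularᴸ finiteᴸ modularᴹ finiteᴹ galois
  , degree-isHNLattice M L rkL isRankᴸ modularᴹ finiteᴹ modularᴸ finiteᴸ
      (isGaloisConnection-sym L M galois)
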